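{- Let $G$ be an acyclic digraph, let $d\ge 0$ be an integer, and let $I=\{(s_1,t_1),\dots,(s_k,t_k)\}$ be a set of $k$ pairs of vertices of $G$ such that for every $1\le i\le k$ there is a path in $G$ linking $s_i$ to $t_i$. Then $G$ contains a $(k-d)$-routing of $I$ if and only if there is a subset $I'\subseteq I$ with $|I'|\le 3d$ such that $G$ contains a $(|I'|-d)$-routing of $I'$. Moreover, if $k\ge 3d$, then $I'$ can be chosen with $|I'|=3d$.
   Context: Digraphs have no loops. A path in a digraph $G$ is a sequence $(v_1,\dots,v_\ell)$ of pairwise distinct vertices with $(v_i,v_{i+1})\in E(G)$ for all $1\le i<\ell$; it links $v_1$ to $v_\ell$. Given a digraph $G$, a set $J=\{(s_1,t_1),\dots,(s_m,t_m)\}$ of pairs of vertices and an integer $c$, a $c$-routing of $J$ is a set $\{P_1,\dots,P_m\}$ of paths such that $P_i$ links $s_i$ to $t_i$ for all $i$, and no vertex of $G$ lies on more than $c$ of the paths. -}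

module Defs where

open import Data.Nat using (ℕ)
open import Data.Fin using (Fin)
open import Data.Fin.Properties using () renaming (_≟_ to _≟ᶠ_)
open import Data.List using (List; []; _∷_; length; filter; allFin)
open import Data.List.Relation.Unary.Unique.Propositional using (Unique)
open import Data.List.Membership.Propositional using (_∈_)
import Data.List.Membership.DecPropositional as DecMem
open import Data.Integer using (ℤ; +_)
open import Data.Product using (Σ; _×_)
open import Relation.Nullary using (¬_; Dec)
open import Relation.Binary.PropositionalEquality using (_≡_)

record Digraph (n : ℕ) : Set₁ where
  field
    Edge     : Fin n → Fin n → Set
    edge?    : ∀ u v → Dec (Edge u v)
    loopless : ∀ v → ¬ Edge v v
open Digraph public

module _ {n : ℕ} (G : Digraph n) where

  open DecMem (_≟ᶠ_ {n}) using (_∈?_)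

  data Walk : Fin n → Fin n → Set where
    [_] : (v : Fin n) → Walk v v
    _∷_ : ∀ {u v w} → Edge G u v → Walk v w → Walk u w

  vertices : ∀ {u w} → Walk u w → List (Fin n)
  vertices [ v ]          = v ∷ []
  vertices (_∷_ {u} e p)  = u ∷ vertices p

  record Path (u w : Fin n) : Set where
    constructor path
    field
      walk     : Walk u w
      distinct : Unique (vertices walk)
  open Path public

  Acyclic : Set
  Acyclic = ∀ u v → Edge G u v → ¬ Path v u

  load : ∀ {m} {s t : Fin m → Fin n} → ((j : Fin m) → Path (s j) (t j)) → Fin n → ℕ
  load {m} P x = length (filter (λ j → x ∈? vertices (walk (P j))) (allFin m))

  Routing : (c : ℤ) {m : ℕ} (s t : Fin m → Fin n) → Set
  Routing c {m} s t =
    Σ ((j : Fin m) → Path (s j) (t j)) λ P → ∀ x → + (load P x) Data.Integer.≤ c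

-- The family (s i, t i), i < k, consists of pairwise distinct pairs (I is a set of k pairs).
DistinctPairs : ∀ {n k : ℕ} → (s t : Fin k → Fin n) → Set
DistinctPairs s t = ∀ i j → s i ≡ s j → t i ≡ t j → i ≡ j

-- Let k > 3d and fix a (k − d)-routing; call a vertex tight if exactly k − d paths use it.
-- The three loads of any three tight vertices sum to more than 2k, so by pigeonhole some path
-- contains all three. In an acyclic digraph two vertices on a common path are comparable by
-- reachability, so the tight vertices form a chain from a lowest lo to a highest hi, and some
-- path P j contains both. If a tight u is missing from P j, take consecutive tight vertices
-- b < u < c of P j and a path P l through b, u and c: exchanging the segments from b to c of
-- P j and P l keeps every load (the multiset of vertices is unchanged) and puts u on P j
-- without losing any tight vertex. Once P j carries every tight vertex, deleting the pair j
-- leaves a (k − 1 − d)-routing; repeating this reaches 3d pairs. Conversely, completing a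
-- routing of m of the pairs by arbitrary paths raises every load by at most k − m.

module Submission where

open import Defs
open import Data.Empty using (⊥; ⊥-elim)
open import Data.Fin using (Fin; zero; suc; punchIn; punchOut; fromℕ<)
open import Data.Fin.Properties
  using (_≟_; any?; punchInᵢ≢i; punchIn-injective; punchIn-punchOut; punchOut-injective; injective⇒≤)
import Data.Fin.Properties as Finₚ
open import Data.Integer using (ℤ; +_; _-_; -_; +≤+) renaming (_≤_ to _≤ℤ_; _+_ to _+ℤ_)
open import Data.Integer.Properties using (+-0-abelianGroup; drop‿+≤+) renaming (+-monoˡ-≤ to +ℤ-monoˡ-≤)
open import Algebra.Properties.AbelianGroup +-0-abelianGroup using (//-rightDividesˡ; //-rightDividesʳ)
open import Data.List using (List; []; _∷_; _++_; length; filter; tabulate; allFin)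
open import Data.List.Properties using (length-++; filter-++)
open import Data.List.Membership.Propositional using (_∈_)
open import Data.List.Membership.Propositional.Properties using (∈-++⁻; ∈-++⁺ˡ; ∈-++⁺ʳ; ∈-allFin)
import Data.List.Membership.DecPropositional as DecMembership
open import Data.List.Relation.Unary.All using ([])
open import Data.List.Relation.Unary.All.Properties.Core using (¬Any⇒All¬; All¬⇒¬Any)
open import Data.List.Relation.Unary.Any using (here; there)
open import Data.List.Relation.Unary.Unique.Propositional using (Unique; []; _∷_)
open import Data.Nat using (ℕ; zero; suc; _+_; _*_; _∸_; _≤_; _<_; z≤n; s≤s; _≤?_)
open import Data.Nat.Induction using (<-wellFounded)
open import Data.Nat.Properties
  using ( +-0-commutativeMonoid; +-commutativeSemigroup; +-assoc; *-comm; +-identityʳ; ≤-refl; ≤-antisym; ≤-pred; <-≤-trans; ≤-<-trans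
        ; <⇒≤; ≰⇒>; ≤∧≢⇒<; +-mono-≤; +-mono-<-≤; +-mono-≤-<; +-monoˡ-≤; +-monoʳ-≤; +-monoʳ-<
        ; +-cancelˡ-<; +-cancelʳ-<; m≤n+m; m∸n+n≡m; m+[n∸m]≡n; module ≤-Reasoning)
import Data.Nat.Properties as ℕₚ
open import Data.Nat.Tactic.RingSolver using (solve-∀)
open import Data.Product using (Σ; Σ-syntax; ∃; ∃-syntax; _×_; _,_; proj₁; proj₂)
open import Data.Sum using (_⊎_; inj₁; inj₂; [_,_]′) renaming (swap to ⊎-swap)
open import Function using (id; _∘_; flip)
open import Function.Bundles using (_⇔_; mk⇔; Equivalence)
open import Function.Definitions using (Injective)
open import Induction.WellFounded using (Acc; acc)
open import Relation.Nullary using (¬_; Dec; yes; no)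
open import Relation.Nullary.Decidable using (_×-dec_; ¬?; decidable-stable)
open import Relation.Unary using (Decidable)
open import Relation.Binary.PropositionalEquality
open import Algebra.Properties.CommutativeSemigroup +-commutativeSemigroup using (xy∙z≈xz∙y)
open import Algebra.Properties.CommutativeMonoid.Sum +-0-commutativeMonoid
  using (sum; sum-remove; sum-cong-≗; ∑-distrib-+)

indicator : ∀ {a} {A : Set a} → Dec A → ℕ
indicator (yes _) = 1
indicator (no _)  = 0

module _ {a} {A : Set a} where

  indicator≤1 : (A? : Dec A) → indicator A? ≤ 1
  indicator≤1 (yes _) = s≤s z≤n
  indicator≤1 (no _)  = z≤n

  indicator-yes : (A? : Dec A) → A → indicator A? ≡ 1
  indicator-yes (yes _) _ = refl
  indicator-yes (no ¬a) a = ⊥-elim (¬a a)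

  indicator-no : (A? : Dec A) → ¬ A → indicator A? ≡ 0
  indicator-no (yes a) ¬a = ⊥-elim (¬a a)
  indicator-no (no _)  _  = refl

  indicator-positive : (A? : Dec A) → 0 < indicator A? → A
  indicator-positive (yes a) _ = a

indicator-mono : ∀ {a b} {A : Set a} {B : Set b} → (A → B) → (A? : Dec A) (B? : Dec B) → indicator A? ≤ indicator B?
indicator-mono f (yes a) (yes _) = ≤-refl
indicator-mono f (yes a) (no ¬b) = ⊥-elim (¬b (f a))
indicator-mono f (no _)  _       = z≤n

indicator-cong : ∀ {a b} {A : Set a} {B : Set b} → (A → B) → (B → A) → (A? : Dec A) (B? : Dec B) → indicator A? ≡ indicator B?
indicator-cong f g A? B? = ≤-antisym (indicator-mono f A? B?) (indicator-mono g B? A?)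

indicator-×₃ : ∀ {a b c} {A : Set a} {B : Set b} {C : Set c} (A? : Dec A) (B? : Dec B) (C? : Dec C) →
  indicator A? + indicator B? + indicator C? ≤ 2 + indicator (A? ×-dec (B? ×-dec C?))
indicator-×₃ (yes _) (yes _) (yes _) = ≤-refl
indicator-×₃ (yes _) (yes _) (no _)  = ≤-refl
indicator-×₃ (yes _) (no _)  (yes _) = ≤-refl
indicator-×₃ (yes _) (no _)  (no _)  = s≤s z≤n
indicator-×₃ (no _)  (yes _) (yes _) = ≤-refl
indicator-×₃ (no _)  (yes _) (no _)  = s≤s z≤n
indicator-×₃ (no _)  (no _)  (yes _) = s≤s z≤n
indicator-×₃ (no _)  (no _)  (no _)  = z≤n

length-filter-tabulate : ∀ {a p} {A : Set a} {P : A → Set p} (P? : Decidable P) {m} (g : Fin m → A) →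
  length (filter P? (tabulate g)) ≡ sum (λ i → indicator (P? (g i)))
length-filter-tabulate P? {zero}  g = refl
length-filter-tabulate P? {suc m} g with P? (g zero)
... | yes _ = cong suc (length-filter-tabulate P? (g ∘ suc))
... | no _  = length-filter-tabulate P? (g ∘ suc)

sum-mono-≤ : ∀ {m} {f g : Fin m → ℕ} → (∀ i → f i ≤ g i) → sum f ≤ sum g
sum-mono-≤ {zero}  f≤g = z≤n
sum-mono-≤ {suc m} f≤g = +-mono-≤ (f≤g zero) (sum-mono-≤ (f≤g ∘ suc))

sum-mono-< : ∀ {m} {f g : Fin m → ℕ} → (∀ i → f i ≤ g i) → ∀ j → f j < g j → sum f < sum g
sum-mono-< {suc m} f≤g zero    fj<gj = +-mono-<-≤ fj<gj (sum-mono-≤ (f≤g ∘ suc))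
sum-mono-< {suc m} f≤g (suc j) fj<gj = +-mono-≤-< (f≤g zero) (sum-mono-< (f≤g ∘ suc) j fj<gj)

sum-const : ∀ {m} c → sum {m} (λ _ → c) ≡ m * c
sum-const {zero}  c = refl
sum-const {suc m} c = cong (_+_ c) (sum-const {m} c)

sum-positive : ∀ {m} (f : Fin m → ℕ) → 0 < sum f → ∃[ i ] 0 < f i
sum-positive {suc m} f 0<∑ with f zero in eq
... | suc _ = zero , subst (0 <_) (sym eq) (s≤s z≤n)
... | zero with sum-positive (f ∘ suc) 0<∑
...   | i , 0<fi = suc i , 0<fi

sum≤length : ∀ {m} (f : Fin m → ℕ) → (∀ i → f i ≤ 1) → sum f ≤ m
sum≤length {zero}  f f≤1 = z≤n
sum≤length {suc m} f f≤1 = +-mono-≤ (f≤1 zero) (sum≤length (f ∘ suc) (f≤1 ∘ suc))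

sum-exchange : ∀ {m} {f g : Fin m → ℕ} {j l : Fin m} → j ≢ l →
  (∀ i → i ≢ j → i ≢ l → g i ≡ f i) → g j + g l ≡ f j + f l → sum g ≡ sum f
sum-exchange {suc zero} {j = zero} {zero} j≢l = ⊥-elim (j≢l refl)
sum-exchange {suc (suc m)} {f} {g} {j} {l} j≢l g≡f gj+gl≡fj+fl = begin
  sum g                          ≡⟨ sum-remove g ⟩
  g j + sum (g ∘ punchIn j)      ≡⟨ cong (_+_ (g j)) (sum-remove (g ∘ punchIn j)) ⟩
  g j + (g (punchIn j l′) + sum (g ∘ rest))  ≡⟨ cong (λ y → g j + (g y + sum (g ∘ rest))) l≡ ⟩
  g j + (g l + sum (g ∘ rest))   ≡⟨ sym (+-assoc (g j) (g l) _) ⟩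
  g j + g l + sum (g ∘ rest)     ≡⟨ cong₂ _+_ gj+gl≡fj+fl (sum-cong-≗ (λ i → g≡f (rest i) (rest≢j i) (rest≢l i))) ⟩
  f j + f l + sum (f ∘ rest)     ≡⟨ +-assoc (f j) (f l) _ ⟩
  f j + (f l + sum (f ∘ rest))   ≡⟨ cong (λ y → f j + (f y + sum (f ∘ rest))) (sym l≡) ⟩
  f j + (f (punchIn j l′) + sum (f ∘ rest))  ≡⟨ cong (_+_ (f j)) (sym (sum-remove (f ∘ punchIn j))) ⟩
  f j + sum (f ∘ punchIn j)      ≡⟨ sym (sum-remove f) ⟩
  sum f                          ∎
  where
  open ≡-Reasoning
  l′ = punchOut j≢l
  l≡ : punchIn j l′ ≡ l
  l≡ = punchIn-punchOut j≢l
  rest : Fin m → Fin (suc (suc m))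
  rest = punchIn j ∘ punchIn l′
  rest≢j : ∀ i → rest i ≢ j
  rest≢j i = punchInᵢ≢i j (punchIn l′ i)
  rest≢l : ∀ i → rest i ≢ l
  rest≢l i eq = punchInᵢ≢i l′ i (punchIn-injective j _ _ (trans eq (sym l≡)))

sum≤sum∘inj+∸ : ∀ {m k} (ι : Fin m → Fin k) → Injective _≡_ _≡_ ι →
  (f : Fin k → ℕ) → (∀ i → f i ≤ 1) → sum f ≤ sum (f ∘ ι) + (k ∸ m)
sum≤sum∘inj+∸ {zero} ι ι-inj f f≤1 = sum≤length f f≤1
sum≤sum∘inj+∸ {suc m} {zero}  ι ι-inj f f≤1 with () ← ι zero
sum≤sum∘inj+∸ {suc m} {suc k} ι ι-inj f f≤1 = begin
  sum f                                        ≡⟨ sum-remove f ⟩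
  f i₀ + sum (f ∘ punchIn i₀)
    ≤⟨ +-monoʳ-≤ (f i₀) (sum≤sum∘inj+∸ ι′ ι′-inj (f ∘ punchIn i₀) (f≤1 ∘ punchIn i₀)) ⟩
  f i₀ + (sum (f ∘ punchIn i₀ ∘ ι′) + (k ∸ m))
    ≡⟨ cong (λ y → f i₀ + (y + (k ∸ m))) (sum-cong-≗ (cong f ∘ punchIn-punchOut ∘ i₀≢)) ⟩
  f i₀ + (sum (f ∘ ι ∘ suc) + (k ∸ m))
    ≡⟨ sym (+-assoc (f i₀) _ _) ⟩
  sum (f ∘ ι) + (suc k ∸ suc m) ∎
  where
  open ≤-Reasoning
  i₀ = ι zero
  i₀≢ : ∀ j → i₀ ≢ ι (suc j)
  i₀≢ j eq with () ← ι-inj eq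
  ι′ : Fin m → Fin k
  ι′ j = punchOut (i₀≢ j)
  ι′-inj : Injective _≡_ _≡_ ι′
  ι′-inj eq = Finₚ.suc-injective (ι-inj (punchOut-injective (i₀≢ _) (i₀≢ _) eq))

module _ {n : ℕ} where

  open DecMembership (_≟_ {n}) using (_∈?_)

  occurrences : Fin n → List (Fin n) → ℕ
  occurrences x xs = length (filter (x ≟_) xs)

  occurrences-++ : ∀ x xs ys → occurrences x (xs ++ ys) ≡ occurrences x xs + occurrences x ys
  occurrences-++ x xs ys = trans (cong length (filter-++ (x ≟_) xs ys)) (length-++ (filter (x ≟_) xs))

  occurrences-unique : ∀ x {xs} → Unique xs → (x∈? : Dec (x ∈ xs)) → occurrences x xs ≡ indicator x∈?
  occurrences-unique x {[]} [] x∈? = sym (indicator-no x∈? λ ())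
  occurrences-unique x {y ∷ ys} (y∉ys ∷ ys-unique) x∈? with x ≟ y
  ... | yes refl = begin
    suc (occurrences x ys)     ≡⟨ cong suc (occurrences-unique x ys-unique (x ∈? ys)) ⟩
    suc (indicator (x ∈? ys))  ≡⟨ cong suc (indicator-no (x ∈? ys) (All¬⇒¬Any y∉ys)) ⟩
    1                          ≡⟨ sym (indicator-yes x∈? (here refl)) ⟩
    indicator x∈?              ∎
    where open ≡-Reasoning
  ... | no x≢y = trans (occurrences-unique x ys-unique (x ∈? ys)) (indicator-cong there ∈-tail (x ∈? ys) x∈?)
    where
    ∈-tail : x ∈ y ∷ ys → x ∈ ys
    ∈-tail (here x≡y) = ⊥-elim (x≢y x≡y)
    ∈-tail (there x∈) = x∈

-- Walks

module _ {n : ℕ} {G : Digraph n} where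

  open DecMembership (_≟_ {n}) using (_∈?_)

  infixr 5 _++ʷ_
  _++ʷ_ : ∀ {a b c} → Walk G a b → Walk G b c → Walk G a c
  [ _ ]    ++ʷ W₂ = W₂
  (e ∷ W₁) ++ʷ W₂ = e ∷ (W₁ ++ʷ W₂)

  ++ʷ-assoc : ∀ {a b c d} (W₁ : Walk G a b) (W₂ : Walk G b c) (W₃ : Walk G c d) →
    (W₁ ++ʷ W₂) ++ʷ W₃ ≡ W₁ ++ʷ (W₂ ++ʷ W₃)
  ++ʷ-assoc [ _ ]    W₂ W₃ = refl
  ++ʷ-assoc (e ∷ W₁) W₂ W₃ = cong (e ∷_) (++ʷ-assoc W₁ W₂ W₃)

  initVertices : ∀ {a b} → Walk G a b → List (Fin n)
  initVertices [ _ ]          = []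
  initVertices (_∷_ {u} _ W)  = u ∷ initVertices W

  vertices-++ʷ : ∀ {a b c} (W₁ : Walk G a b) (W₂ : Walk G b c) →
    vertices G (W₁ ++ʷ W₂) ≡ initVertices W₁ ++ vertices G W₂
  vertices-++ʷ [ _ ]             W₂ = refl
  vertices-++ʷ (_∷_ {u} _ W₁) W₂ = cong (u ∷_) (vertices-++ʷ W₁ W₂)

  ∈-++ʷ⁻ : ∀ {a b c x} (W₁ : Walk G a b) (W₂ : Walk G b c) →
    x ∈ vertices G (W₁ ++ʷ W₂) → x ∈ initVertices W₁ ⊎ x ∈ vertices G W₂
  ∈-++ʷ⁻ W₁ W₂ x∈ = ∈-++⁻ (initVertices W₁) (subst (_ ∈_) (vertices-++ʷ W₁ W₂) x∈)

  ∈-++ʷ⁺ˡ : ∀ {a b c x} (W₁ : Walk G a b) (W₂ : Walk G b c) →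
    x ∈ initVertices W₁ → x ∈ vertices G (W₁ ++ʷ W₂)
  ∈-++ʷ⁺ˡ W₁ W₂ x∈ = subst (_ ∈_) (sym (vertices-++ʷ W₁ W₂)) (∈-++⁺ˡ x∈)

  ∈-++ʷ⁺ʳ : ∀ {a b c x} (W₁ : Walk G a b) (W₂ : Walk G b c) →
    x ∈ vertices G W₂ → x ∈ vertices G (W₁ ++ʷ W₂)
  ∈-++ʷ⁺ʳ W₁ W₂ x∈ = subst (_ ∈_) (sym (vertices-++ʷ W₁ W₂)) (∈-++⁺ʳ (initVertices W₁) x∈)

  ∈-++ʷ-middle : ∀ {a b c z x} (W₁ : Walk G a b) (W₂ : Walk G b c) (W₃ : Walk G c z) →
    x ∈ initVertices W₂ → x ∈ vertices G (W₁ ++ʷ W₂ ++ʷ W₃)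
  ∈-++ʷ-middle W₁ W₂ W₃ x∈ = ∈-++ʷ⁺ʳ W₁ (W₂ ++ʷ W₃) (∈-++ʷ⁺ˡ W₂ W₃ x∈)

  ∈-++ʷ-replace-middle : ∀ {a b c z x} (W₁ : Walk G a b) (W₂ W₂′ : Walk G b c) (W₃ : Walk G c z) →
    x ∈ vertices G (W₁ ++ʷ W₂ ++ʷ W₃) → x ∈ initVertices W₂ ⊎ x ∈ vertices G (W₁ ++ʷ W₂′ ++ʷ W₃)
  ∈-++ʷ-replace-middle W₁ W₂ W₂′ W₃ x∈ with ∈-++ʷ⁻ W₁ (W₂ ++ʷ W₃) x∈
  ... | inj₁ x∈W₁ = inj₂ (∈-++ʷ⁺ˡ W₁ (W₂′ ++ʷ W₃) x∈W₁)
  ... | inj₂ x∈W₂W₃ with ∈-++ʷ⁻ W₂ W₃ x∈W₂W₃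
  ...   | inj₁ x∈W₂ = inj₁ x∈W₂
  ...   | inj₂ x∈W₃ = inj₂ (∈-++ʷ⁺ʳ W₁ (W₂′ ++ʷ W₃) (∈-++ʷ⁺ʳ W₂′ W₃ x∈W₃))

  source∈vertices : ∀ {a b} (W : Walk G a b) → a ∈ vertices G W
  source∈vertices [ _ ]   = here refl
  source∈vertices (_ ∷ _) = here refl

  target∈vertices : ∀ {a b} (W : Walk G a b) → b ∈ vertices G W
  target∈vertices [ _ ]   = here refl
  target∈vertices (_ ∷ W) = there (target∈vertices W)

  Split : ∀ {a b} → Walk G a b → Fin n → Set
  Split {a} {b} W x = Σ (Walk G a x) λ W₁ → Σ (Walk G x b) λ W₂ → W ≡ W₁ ++ʷ W₂

  split : ∀ {a b x} (W : Walk G a b) → x ∈ vertices G W → Split W x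
  split [ v ]            (here refl) = [ v ] , [ v ] , refl
  split (_∷_ {u} e W)    (here refl) = [ u ] , e ∷ W , refl
  split (e ∷ W)          (there x∈) with split W x∈
  ... | W₁ , W₂ , W≡ = e ∷ W₁ , W₂ , cong (e ∷_) W≡

  walk-to-∈ : ∀ {a b x} (W : Walk G a b) → x ∈ vertices G W → Walk G a x
  walk-to-∈ W x∈ = proj₁ (split W x∈)

  Walk⁺ : Fin n → Fin n → Set
  Walk⁺ x y = Σ (Fin n) λ v → Edge G x v × Walk G v y

  walk⁺-from-initVertices : ∀ {a b x} (W : Walk G a b) → x ∈ initVertices W → Walk⁺ x b
  walk⁺-from-initVertices (e ∷ W) (here refl) = _ , e , W
  walk⁺-from-initVertices (e ∷ W) (there x∈) = walk⁺-from-initVertices W x∈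

  ∈-walk-comparable : ∀ {a b x y} (W : Walk G a b) → x ∈ vertices G W → y ∈ vertices G W →
    Walk G x y ⊎ Walk G y x
  ∈-walk-comparable W x∈ y∈ with split W x∈
  ... | W₁ , W₂ , refl with ∈-++ʷ⁻ W₁ W₂ y∈
  ...   | inj₁ y∈W₁ = inj₂ (let (_ , e , W′) = walk⁺-from-initVertices W₁ y∈W₁ in e ∷ W′)
  ...   | inj₂ y∈W₂ = inj₁ (walk-to-∈ W₂ y∈W₂)

  shortcut : ∀ {a b} → Walk G a b → Path G a b
  shortcut [ v ] = path [ v ] ([] ∷ [])
  shortcut (_∷_ {a} e W) with shortcut W
  ... | path W′ W′-distinct with a ∈? vertices G W′
  ...   | no a∉ = path (e ∷ W′) (¬Any⇒All¬ _ a∉ ∷ W′-distinct)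
  ...   | yes a∈ with split W′ a∈
  ...     | W₁ , W₂ , refl = path W₂ (Unique-++ʳ (initVertices W₁) (subst Unique (vertices-++ʷ W₁ W₂) W′-distinct))
    where
    Unique-++ʳ : ∀ xs {ys} → Unique (xs ++ ys) → Unique ys
    Unique-++ʳ []       u       = u
    Unique-++ʳ (_ ∷ xs) (_ ∷ u) = Unique-++ʳ xs u

  occurrences-++ʷ : ∀ x {a b c} (W₁ : Walk G a b) (W₂ : Walk G b c) →
    occurrences x (vertices G (W₁ ++ʷ W₂)) ≡ occurrences x (initVertices W₁) + occurrences x (vertices G W₂)
  occurrences-++ʷ x W₁ W₂ = trans (cong (occurrences x) (vertices-++ʷ W₁ W₂)) (occurrences-++ x (initVertices W₁) _)

  occurrences-swap : ∀ x {a b c d a′ d′}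
    (A₁ : Walk G a b) (A₂ : Walk G b c) (A₃ : Walk G c d) (Q₁ : Walk G a′ b) (Q₂ : Walk G b c) (Q₃ : Walk G c d′) →
    occurrences x (vertices G (A₁ ++ʷ Q₂ ++ʷ A₃)) + occurrences x (vertices G (Q₁ ++ʷ A₂ ++ʷ Q₃)) ≡
    occurrences x (vertices G (A₁ ++ʷ A₂ ++ʷ A₃)) + occurrences x (vertices G (Q₁ ++ʷ Q₂ ++ʷ Q₃))
  occurrences-swap x A₁ A₂ A₃ Q₁ Q₂ Q₃ = begin
    o (A₁ ++ʷ Q₂ ++ʷ A₃) + o (Q₁ ++ʷ A₂ ++ʷ Q₃)
      ≡⟨ cong₂ _+_ (split₃ A₁ Q₂ A₃) (split₃ Q₁ A₂ Q₃) ⟩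
    oᵢ A₁ + (oᵢ Q₂ + o A₃) + (oᵢ Q₁ + (oᵢ A₂ + o Q₃))
      ≡⟨ interchange (oᵢ A₁) (oᵢ A₂) (o A₃) (oᵢ Q₁) (oᵢ Q₂) (o Q₃) ⟩
    oᵢ A₁ + (oᵢ A₂ + o A₃) + (oᵢ Q₁ + (oᵢ Q₂ + o Q₃))
      ≡⟨ sym (cong₂ _+_ (split₃ A₁ A₂ A₃) (split₃ Q₁ Q₂ Q₃)) ⟩
    o (A₁ ++ʷ A₂ ++ʷ A₃) + o (Q₁ ++ʷ Q₂ ++ʷ Q₃) ∎
    where
    open ≡-Reasoning
    o : ∀ {a b} → Walk G a b → ℕ
    o W = occurrences x (vertices G W)
    oᵢ : ∀ {a b} → Walk G a b → ℕ
    oᵢ W = occurrences x (initVertices W)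
    split₃ : ∀ {a b c d} (W₁ : Walk G a b) (W₂ : Walk G b c) (W₃ : Walk G c d) →
      o (W₁ ++ʷ W₂ ++ʷ W₃) ≡ oᵢ W₁ + (oᵢ W₂ + o W₃)
    split₃ W₁ W₂ W₃ = trans (occurrences-++ʷ x W₁ (W₂ ++ʷ W₃)) (cong (_+_ (oᵢ W₁)) (occurrences-++ʷ x W₂ W₃))
    interchange : ∀ a₁ a₂ a₃ q₁ q₂ q₃ →
      a₁ + (q₂ + a₃) + (q₁ + (a₂ + q₃)) ≡ a₁ + (a₂ + a₃) + (q₁ + (q₂ + q₃))
    interchange = solve-∀

  vertices-snoc : ∀ {a x y} (W : Walk G a x) (e : Edge G x y) → vertices G (W ++ʷ (e ∷ [ y ])) ≡ vertices G W ++ y ∷ []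
  vertices-snoc [ _ ]   e = refl
  vertices-snoc (_∷_ {u} e′ W) e = cong (u ∷_) (vertices-snoc W e)

  initVertices-snoc : ∀ {a x y} (W : Walk G a x) (e : Edge G x y) → initVertices (W ++ʷ (e ∷ [ y ])) ≡ vertices G W
  initVertices-snoc [ _ ]   e = refl
  initVertices-snoc (_∷_ {u} e′ W) e = cong (u ∷_) (initVertices-snoc W e)

module Crossing {n : ℕ} {G : Digraph n} {Mark Low High : Fin n → Set} (mark? : Decidable Mark)
  (classify : ∀ {w} → Mark w → Low w ⊎ High w) (apart : ∀ {w} → Mark w → Low w → High w → ⊥) where

  record Crossing {a z} (W : Walk G a z) : Set where
    field
      {b c}    : Fin n
      b-mark   : Mark b
      b-low    : Low b
      c-mark   : Mark c
      c-high   : High c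
      A₁       : Walk G a b
      A₂       : Walk G b c
      A₃       : Walk G c z
      W≡       : W ≡ A₁ ++ʷ A₂ ++ʷ A₃
      unmarked : ∀ {w} → w ∈ initVertices A₂ → Mark w → w ≡ b

  private
    scan : ∀ {a b x z} (W : Walk G a z) (A₁ : Walk G a b) (S : Walk G b x) (R : Walk G x z) →
      W ≡ A₁ ++ʷ S ++ʷ R → Mark b → Low b → (∀ {w} → w ∈ vertices G S → Mark w → w ≡ b) →
      ∀ {h} → h ∈ vertices G R → Mark h → High h → Crossing W
    scan W A₁ S [ x ]   W≡ b-mark b-low S-unmarked (here refl) h-mark h-high =
      ⊥-elim (apart b-mark b-low (subst High (S-unmarked (target∈vertices S) h-mark) h-high))
    scan W A₁ S (e ∷ R) W≡ b-mark b-low S-unmarked (here refl) h-mark h-high =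
      ⊥-elim (apart b-mark b-low (subst High (S-unmarked (target∈vertices S) h-mark) h-high))
    scan {b = b} W A₁ S (_∷_ {v = y} e R) W≡ b-mark b-low S-unmarked (there h∈R) h-mark h-high with mark? y
    ... | no ¬y-mark = scan W A₁ (S ++ʷ e ∷ [ y ]) R W≡′ b-mark b-low S′-unmarked h∈R h-mark h-high
      where
      W≡′ : W ≡ A₁ ++ʷ (S ++ʷ e ∷ [ y ]) ++ʷ R
      W≡′ = trans W≡ (cong (A₁ ++ʷ_) (sym (++ʷ-assoc S (e ∷ [ y ]) R)))
      S′-unmarked : ∀ {w} → w ∈ vertices G (S ++ʷ e ∷ [ y ]) → Mark w → w ≡ b
      S′-unmarked w∈ w-mark with ∈-++⁻ (vertices G S) (subst (_ ∈_) (vertices-snoc S e) w∈)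
      ... | inj₁ w∈S        = S-unmarked w∈S w-mark
      ... | inj₂ (here refl) = ⊥-elim (¬y-mark w-mark)
    ... | yes y-mark with classify y-mark
    ...   | inj₂ y-high = record
      { b-mark = b-mark ; b-low = b-low ; c-mark = y-mark ; c-high = y-high
      ; A₁ = A₁ ; A₂ = S ++ʷ e ∷ [ y ] ; A₃ = R
      ; W≡ = trans W≡ (cong (A₁ ++ʷ_) (sym (++ʷ-assoc S (e ∷ [ y ]) R)))
      ; unmarked = λ w∈ → S-unmarked (subst (_ ∈_) (initVertices-snoc S e) w∈)
      }
    ...   | inj₁ y-low = scan W (A₁ ++ʷ S ++ʷ e ∷ [ y ]) [ y ] R W≡′ y-mark y-low (λ { (here refl) _ → refl }) h∈R h-mark h-high
      where
      W≡′ : W ≡ (A₁ ++ʷ S ++ʷ e ∷ [ y ]) ++ʷ R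
      W≡′ = trans W≡ (trans (cong (A₁ ++ʷ_) (sym (++ʷ-assoc S (e ∷ [ y ]) R))) (sym (++ʷ-assoc A₁ _ R)))

  crossing : ∀ {a x z h} (W₁ : Walk G a x) (W₂ : Walk G x z) → Mark x → Low x →
    h ∈ vertices G W₂ → Mark h → High h → Crossing (W₁ ++ʷ W₂)
  crossing {x = x} W₁ W₂ x-mark x-low = scan (W₁ ++ʷ W₂) W₁ [ x ] W₂ refl x-mark x-low λ { (here refl) _ → refl }

-- Walks in acyclic digraphs

module _ {n : ℕ} {G : Digraph n} (acyclic : Acyclic G) where

  no-cycle : ∀ {x y} → Walk⁺ {G = G} x y → ¬ Walk G y x
  no-cycle (v , e , W) W′ = acyclic _ v e (shortcut (W ++ʷ W′))

  walk-antisym : ∀ {x y} → Walk G x y → Walk G y x → x ≡ y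
  walk-antisym [ _ ]   _  = refl
  walk-antisym (e ∷ W) W′ = ⊥-elim (no-cycle (_ , e , W) W′)

  walk-distinct : ∀ {a b} (W : Walk G a b) → Unique (vertices G W)
  walk-distinct [ v ]         = [] ∷ []
  walk-distinct (_∷_ {a} e W) = ¬Any⇒All¬ _ (λ a∈W → no-cycle (_ , e , walk-to-∈ W a∈W) [ a ]) ∷ walk-distinct W

  toPath : ∀ {a b} → Walk G a b → Path G a b
  toPath W = path W (walk-distinct W)

  split-before : ∀ {a z x y} (W : Walk G a z) → x ∈ vertices G W → y ∈ vertices G W → Walk G x y →
    Σ (Walk G a x) λ W₁ → Σ (Walk G x z) λ W₂ → W ≡ W₁ ++ʷ W₂ × y ∈ vertices G W₂
  split-before W x∈ y∈ x→y with split W x∈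
  ... | W₁ , W₂ , refl with ∈-++ʷ⁻ W₁ W₂ y∈
  ...   | inj₁ y∈W₁ = ⊥-elim (no-cycle (walk⁺-from-initVertices W₁ y∈W₁) x→y)
  ...   | inj₂ y∈W₂ = W₁ , W₂ , refl , y∈W₂

  split-between : ∀ {a z x y w} (W : Walk G a z) → x ∈ vertices G W → y ∈ vertices G W → w ∈ vertices G W →
    Walk G x y → Walk G y w → y ≢ w →
    Σ (Walk G a x) λ W₁ → Σ (Walk G x w) λ W₂ → Σ (Walk G w z) λ W₃ →
      W ≡ W₁ ++ʷ W₂ ++ʷ W₃ × y ∈ initVertices W₂
  split-between W x∈ y∈ w∈ x→y y→w y≢w with split-before W x∈ w∈ (x→y ++ʷ y→w)
  ... | W₁ , W₂ , refl , w∈W₂ with ∈-++ʷ⁻ W₁ W₂ y∈ | split W₂ w∈W₂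
  ...   | inj₁ y∈W₁ | _ = ⊥-elim (no-cycle (walk⁺-from-initVertices W₁ y∈W₁) x→y)
  ...   | inj₂ y∈W₂ | V₂ , W₃ , refl with ∈-++ʷ⁻ V₂ W₃ y∈W₂
  ...     | inj₁ y∈V₂ = W₁ , V₂ , W₃ , refl , y∈V₂
  ...     | inj₂ y∈W₃ = ⊥-elim (y≢w (walk-antisym y→w (walk-to-∈ W₃ y∈W₃)))

-- Families of paths and their loads

Family : ∀ {n} (G : Digraph n) {k} → (s t : Fin k → Fin n) → Set
Family G {k} s t = (j : Fin k) → Path G (s j) (t j)

SubRouting : ∀ {n} (G : Digraph n) (d : ℕ) {k} (s t : Fin k → Fin n) (m : ℕ) → Set
SubRouting G d {k} s t m = Σ[ ι ∈ (Fin m → Fin k) ] Injective _≡_ _≡_ ι × Routing G (+ m - + d) (s ∘ ι) (t ∘ ι)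

module _ {n : ℕ} {G : Digraph n} where

  open DecMembership (_≟_ {n}) using (_∈?_)

  _∈ᵖ_ : ∀ {a b} → Fin n → Path G a b → Set
  x ∈ᵖ p = x ∈ vertices G (walk p)

  _∈ᵖ?_ : ∀ {a b} x (p : Path G a b) → Dec (x ∈ᵖ p)
  x ∈ᵖ? p = x ∈? vertices G (walk p)

  module _ {k} {s t : Fin k → Fin n} where

    load-sum : (P : Family G s t) (x : Fin n) → load G P x ≡ sum (λ j → indicator (x ∈ᵖ? P j))
    load-sum P x = length-filter-tabulate (λ j → x ∈ᵖ? P j) id

    replace₂ : Family G s t → (j l : Fin k) → Path G (s j) (t j) → Path G (s l) (t l) → Family G s t
    replace₂ P j l p q i with i ≟ j | i ≟ l
    ... | yes refl | _        = p
    ... | no _     | yes refl = q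
    ... | no _     | no _     = P i

    module _ (P : Family G s t) {j l : Fin k} (j≢l : j ≢ l) (p : Path G (s j) (t j)) (q : Path G (s l) (t l)) where

      replace₂-j : replace₂ P j l p q j ≡ p
      replace₂-j with j ≟ j
      ... | yes refl = refl
      ... | no j≢j   = ⊥-elim (j≢j refl)

      replace₂-l : replace₂ P j l p q l ≡ q
      replace₂-l with l ≟ j | l ≟ l
      ... | yes l≡j | _        = ⊥-elim (j≢l (sym l≡j))
      ... | no _    | yes refl = refl
      ... | no _    | no l≢l   = ⊥-elim (l≢l refl)

      replace₂-other : ∀ {i} → i ≢ j → i ≢ l → replace₂ P j l p q i ≡ P i
      replace₂-other {i} i≢j i≢l with i ≟ j | i ≟ l
      ... | yes i≡j | _       = ⊥-elim (i≢j i≡j)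
      ... | no _    | yes i≡l = ⊥-elim (i≢l i≡l)
      ... | no _    | no _    = refl

      load-replace₂ : (∀ x → indicator (x ∈ᵖ? p) + indicator (x ∈ᵖ? q) ≡ indicator (x ∈ᵖ? P j) + indicator (x ∈ᵖ? P l)) →
        ∀ x → load G (replace₂ P j l p q) x ≡ load G P x
      load-replace₂ same x = begin
        load G (replace₂ P j l p q) x
          ≡⟨ load-sum (replace₂ P j l p q) x ⟩
        sum (λ i → indicator (x ∈ᵖ? replace₂ P j l p q i))
          ≡⟨ sum-exchange j≢l unchanged (trans (cong₂ _+_ (on replace₂-j) (on replace₂-l)) (same x)) ⟩
        sum (λ i → indicator (x ∈ᵖ? P i))
          ≡⟨ sym (load-sum P x) ⟩
        load G P x ∎
        where
        open ≡-Reasoning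
        on : ∀ {i} {p′ p″ : Path G (s i) (t i)} → p′ ≡ p″ → indicator (x ∈ᵖ? p′) ≡ indicator (x ∈ᵖ? p″)
        on refl = refl
        unchanged : ∀ i → i ≢ j → i ≢ l → indicator (x ∈ᵖ? replace₂ P j l p q i) ≡ indicator (x ∈ᵖ? P i)
        unchanged i i≢j i≢l = on (replace₂-other i≢j i≢l)

  indicator-∈ᵖ : ∀ {a b} x (p : Path G a b) → indicator (x ∈ᵖ? p) ≡ occurrences x (vertices G (walk p))
  indicator-∈ᵖ x p = sym (occurrences-unique x (distinct p) (x ∈ᵖ? p))

module SwapSegments {n : ℕ} {G : Digraph n} (acyclic : Acyclic G) {k : ℕ} {s t : Fin k → Fin n}
  (P : Family G s t) {j l : Fin k} (j≢l : j ≢ l) {b c : Fin n}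
  (A₁ : Walk G (s j) b) (A₂ : Walk G b c) (A₃ : Walk G c (t j)) (P-j : walk (P j) ≡ A₁ ++ʷ A₂ ++ʷ A₃)
  (Q₁ : Walk G (s l) b) (Q₂ : Walk G b c) (Q₃ : Walk G c (t l)) (P-l : walk (P l) ≡ Q₁ ++ʷ Q₂ ++ʷ Q₃) where

  swapped : Family G s t
  swapped = replace₂ P j l (toPath acyclic (A₁ ++ʷ Q₂ ++ʷ A₃)) (toPath acyclic (Q₁ ++ʷ A₂ ++ʷ Q₃))

  swapped-j : walk (swapped j) ≡ A₁ ++ʷ Q₂ ++ʷ A₃
  swapped-j = cong walk (replace₂-j P j≢l _ _)

  load-swapped : ∀ x → load G swapped x ≡ load G P x
  load-swapped = load-replace₂ P j≢l _ _ λ x → begin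
    indicator (x ∈ᵖ? toPath acyclic (A₁ ++ʷ Q₂ ++ʷ A₃)) + indicator (x ∈ᵖ? toPath acyclic (Q₁ ++ʷ A₂ ++ʷ Q₃))
      ≡⟨ cong₂ _+_ (indicator-∈ᵖ x (toPath acyclic (A₁ ++ʷ Q₂ ++ʷ A₃)))
                   (indicator-∈ᵖ x (toPath acyclic (Q₁ ++ʷ A₂ ++ʷ Q₃))) ⟩
    occurrences x (vertices G (A₁ ++ʷ Q₂ ++ʷ A₃)) + occurrences x (vertices G (Q₁ ++ʷ A₂ ++ʷ Q₃))
      ≡⟨ occurrences-swap x A₁ A₂ A₃ Q₁ Q₂ Q₃ ⟩
    occurrences x (vertices G (A₁ ++ʷ A₂ ++ʷ A₃)) + occurrences x (vertices G (Q₁ ++ʷ Q₂ ++ʷ Q₃))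
      ≡⟨ sym (cong₂ _+_ (trans (indicator-∈ᵖ x (P j)) (cong (occurrences x ∘ vertices G) P-j))
                        (trans (indicator-∈ᵖ x (P l)) (cong (occurrences x ∘ vertices G) P-l))) ⟩
    indicator (x ∈ᵖ? P j) + indicator (x ∈ᵖ? P l) ∎
    where open ≡-Reasoning

module _ {n : ℕ} {G : Digraph n} {k : ℕ} {s t : Fin k → Fin n} where

  -- Pigeonhole: each path contributes at most 2 to the sum of the three loads unless it contains all three.
  shared-path : (P : Family G s t) {x y z : Fin n} → 2 * k < load G P x + load G P y + load G P z →
    ∃[ l ] (x ∈ᵖ P l × y ∈ᵖ P l × z ∈ᵖ P l)
  shared-path P {x} {y} {z} 2k<loads with sum-positive all-three 0<∑
    where
    χ : Fin n → Fin k → ℕ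
    χ v l = indicator (v ∈ᵖ? P l)
    all-three : Fin k → ℕ
    all-three l = indicator (x ∈ᵖ? P l ×-dec (y ∈ᵖ? P l ×-dec z ∈ᵖ? P l))
    loads≤ : load G P x + load G P y + load G P z ≤ 2 * k + sum all-three
    loads≤ = begin
      load G P x + load G P y + load G P z
        ≡⟨ cong₂ _+_ (cong₂ _+_ (load-sum P x) (load-sum P y)) (load-sum P z) ⟩
      sum (χ x) + sum (χ y) + sum (χ z)
        ≡⟨ sym (trans (∑-distrib-+ (λ l → χ x l + χ y l) (χ z)) (cong (_+ sum (χ z)) (∑-distrib-+ (χ x) (χ y)))) ⟩
      sum (λ l → χ x l + χ y l + χ z l)
        ≤⟨ sum-mono-≤ (λ l → indicator-×₃ (x ∈ᵖ? P l) (y ∈ᵖ? P l) (z ∈ᵖ? P l)) ⟩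
      sum (λ l → 2 + all-three l)
        ≡⟨ ∑-distrib-+ (λ _ → 2) all-three ⟩
      sum {k} (λ _ → 2) + sum all-three
        ≡⟨ cong (_+ sum all-three) (trans (sum-const {k} 2) (*-comm k 2)) ⟩
      2 * k + sum all-three ∎
      where open ≤-Reasoning
    0<∑ : 0 < sum all-three
    0<∑ = +-cancelˡ-< (2 * k) 0 _ (subst (_< 2 * k + sum all-three) (sym (+-identityʳ (2 * k))) (<-≤-trans 2k<loads loads≤))
  ... | l , 0<l = l , indicator-positive (x ∈ᵖ? P l ×-dec (y ∈ᵖ? P l ×-dec z ∈ᵖ? P l)) 0<l

-- Tight vertices

module _ {a r q} {A : Set a} {R : A → A → Set r} {Q : A → Set q}
  (R-trans : ∀ {x y z} → R x y → R y z → R x z) (R-refl : ∀ {x} → R x x)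
  (Q? : Decidable Q) (R-total : ∀ {x y} → Q x → Q y → R x y ⊎ R y x) where

  least : ∀ {x₀} → Q x₀ → (xs : List A) → Σ[ m ∈ A ] Q m × (∀ {w} → w ∈ xs → Q w → R m w)
  least q₀ [] = _ , q₀ , λ ()
  least q₀ (x ∷ xs) with least q₀ xs | Q? x
  ... | m , qm , m≤ | no ¬qx = m , qm , λ { (here refl) qx → ⊥-elim (¬qx qx) ; (there w∈) qw → m≤ w∈ qw }
  ... | m , qm , m≤ | yes qx with R-total qx qm
  ...   | inj₁ x≤m = x , qx , λ { (here refl) _ → R-refl ; (there w∈) qw → R-trans x≤m (m≤ w∈ qw) }
  ...   | inj₂ m≤x = m , qm , λ { (here refl) _ → m≤x ; (there w∈) qw → m≤ w∈ qw }

three-tight-sum>2k : ∀ {k} d a b c → 3 * d < k → a + d ≡ k → b + d ≡ k → c + d ≡ k → 2 * k < a + b + c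
three-tight-sum>2k {k} d a b c 3d<k a+d≡k b+d≡k c+d≡k = +-cancelʳ-< (3 * d) (2 * k) (a + b + c) (begin-strict
  2 * k + 3 * d               <⟨ +-monoʳ-< (2 * k) 3d<k ⟩
  2 * k + k                   ≡⟨ triple k ⟩
  k + k + k                   ≡⟨ sym (cong₂ _+_ (cong₂ _+_ a+d≡k b+d≡k) c+d≡k) ⟩
  (a + d) + (b + d) + (c + d) ≡⟨ regroup a b c d ⟩
  a + b + c + 3 * d           ∎)
  where
  open ≤-Reasoning
  triple : ∀ k → 2 * k + k ≡ k + k + k
  triple = solve-∀
  regroup : ∀ a b c d → (a + d) + (b + d) + (c + d) ≡ a + b + c + 3 * d
  regroup = solve-∀

module Tight {n : ℕ} {G : Digraph n} (acyclic : Acyclic G) {k : ℕ} {s t : Fin k → Fin n}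
  {d : ℕ} (3d<k : 3 * d < k) (P₀ : Family G s t) where

  Tight : Fin n → Set
  Tight x = load G P₀ x + d ≡ k

  tight? : Decidable Tight
  tight? x = load G P₀ x + d ℕₚ.≟ k

  tight-shared-path : ∀ {P : Family G s t} → load G P ≗ load G P₀ →
    ∀ {x y z} → Tight x → Tight y → Tight z → ∃[ l ] (x ∈ᵖ P l × y ∈ᵖ P l × z ∈ᵖ P l)
  tight-shared-path {P} P≗P₀ {x} {y} {z} x-tight y-tight z-tight = shared-path P
    (three-tight-sum>2k d (load G P x) (load G P y) (load G P z) 3d<k (on-P x-tight) (on-P y-tight) (on-P z-tight))
    where
    on-P : ∀ {w} → Tight w → load G P w + d ≡ k
    on-P {w} = trans (cong (_+ d) (P≗P₀ w))

  tight-comparable : ∀ {x y} → Tight x → Tight y → Walk G x y ⊎ Walk G y x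
  tight-comparable x-tight y-tight =
    let l , x∈ , y∈ , _ = tight-shared-path {P₀} (λ _ → refl) x-tight y-tight y-tight
    in ∈-walk-comparable (walk (P₀ l)) x∈ y∈

  Saturated : Fin k → Family G s t → Set
  Saturated j P = load G P ≗ load G P₀ × (∀ {w} → Tight w → w ∈ᵖ P j)

  TightRange : Fin n → Fin n → Set
  TightRange lo hi = Tight lo × Tight hi × (∀ {w} → Tight w → Walk G lo w × Walk G w hi)

  module Around {u : Fin n} (u-tight : Tight u) = Crossing {G = G} {Mark = λ w → Tight w × w ≢ u} {Low = λ w → Walk G w u} {High = Walk G u}
    (λ w → tight? w ×-dec ¬? (w ≟ u))
    (λ (w-tight , _) → tight-comparable w-tight u-tight)
    (λ (_ , w≢u) w→u u→w → w≢u (walk-antisym acyclic w→u u→w))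

  module Saturation (j : Fin k) {lo hi : Fin n} (lo-tight : Tight lo) (hi-tight : Tight hi)
    (between : ∀ {w} → Tight w → Walk G lo w × Walk G w hi) where

    crossing-at : (P : Family G s t) → lo ∈ᵖ P j → hi ∈ᵖ P j → ∀ {u} (u-tight : Tight u) → ¬ u ∈ᵖ P j →
      Around.Crossing u-tight (walk (P j))
    crossing-at P lo∈ hi∈ {u} u-tight u∉ =
      let W₁ , W₂ , P-j≡ , hi∈W₂ = split-before acyclic (walk (P j)) lo∈ hi∈ (proj₁ (between hi-tight))
      in subst (Around.Crossing u-tight) (sym P-j≡)
           (Around.crossing u-tight W₁ W₂ (lo-tight , ≢u lo∈) (proj₁ (between u-tight))
                                        hi∈W₂ (hi-tight , ≢u hi∈) (proj₂ (between u-tight)))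
      where
      ≢u : ∀ {w} → w ∈ᵖ P j → w ≢ u
      ≢u w∈ refl = u∉ w∈

    Improvement : Family G s t → Fin n → Set
    Improvement P u =
      Σ[ P′ ∈ Family G s t ] load G P′ ≗ load G P₀ × (∀ {w} → Tight w → w ∈ᵖ P j → w ∈ᵖ P′ j) × u ∈ᵖ P′ j

    -- Exchanging the segments between b and c of P j and of a path through b, u and c.
    improve : (P : Family G s t) → load G P ≗ load G P₀ → ∀ {u} (u-tight : Tight u) → ¬ u ∈ᵖ P j →
      Around.Crossing u-tight (walk (P j)) → Improvement P u
    improve P P≗P₀ {u} u-tight u∉
      record { b = b ; c = c ; b-mark = b-tight , _ ; b-low = b→u ; c-mark = c-tight , c≢u ; c-high = u→c
             ; A₁ = A₁ ; A₂ = A₂ ; A₃ = A₃ ; W≡ = P-j≡ ; unmarked = unmarked } =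
      through (tight-shared-path {P} P≗P₀ b-tight u-tight c-tight)
      where
      swap : ∀ l → j ≢ l → (Σ (Walk G (s l) b) λ Q₁ → Σ (Walk G b c) λ Q₂ → Σ (Walk G c (t l)) λ Q₃ →
        walk (P l) ≡ Q₁ ++ʷ Q₂ ++ʷ Q₃ × u ∈ initVertices Q₂) → Improvement P u
      swap l j≢l (Q₁ , Q₂ , Q₃ , P-l≡ , u∈Q₂) =
        swapped , (λ x → trans (load-swapped x) (P≗P₀ x)) , keep , on-swapped (∈-++ʷ-middle A₁ Q₂ A₃ u∈Q₂)
        where
        open SwapSegments acyclic P j≢l A₁ A₂ A₃ P-j≡ Q₁ Q₂ Q₃ P-l≡
        on-swapped : ∀ {w} → w ∈ vertices G (A₁ ++ʷ Q₂ ++ʷ A₃) → w ∈ᵖ swapped j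
        on-swapped {w} = subst (λ W → w ∈ vertices G W) (sym swapped-j)
        keep : ∀ {w} → Tight w → w ∈ᵖ P j → w ∈ᵖ swapped j
        keep {w} w-tight w∈ = [ on-b ∘ (λ w∈A₂ → unmarked w∈A₂ (w-tight , λ { refl → u∉ w∈ })) , on-swapped ]′
          (∈-++ʷ-replace-middle A₁ A₂ Q₂ A₃ (subst (λ W → w ∈ vertices G W) P-j≡ w∈))
          where
          on-b : w ≡ b → w ∈ᵖ swapped j
          on-b refl = on-swapped (∈-++ʷ⁺ʳ A₁ (Q₂ ++ʷ A₃) (source∈vertices (Q₂ ++ʷ A₃)))
      through : ∃[ l ] (b ∈ᵖ P l × u ∈ᵖ P l × c ∈ᵖ P l) → Improvement P u
      through (l , b∈ , u∈ , c∈) =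
        swap l (λ { refl → u∉ u∈ }) (split-between acyclic (walk (P l)) b∈ u∈ c∈ b→u u→c (c≢u ∘ sym))

    misplaced? : (P : Family G s t) (w : Fin n) → Dec (Tight w × ¬ w ∈ᵖ P j)
    misplaced? P w = tight? w ×-dec ¬? (w ∈ᵖ? P j)

    misplaced : Family G s t → ℕ
    misplaced P = sum (indicator ∘ misplaced? P)

    misplaced-< : ∀ P P′ {u} → (∀ {w} → Tight w → w ∈ᵖ P j → w ∈ᵖ P′ j) →
      Tight u → ¬ u ∈ᵖ P j → u ∈ᵖ P′ j → misplaced P′ < misplaced P
    misplaced-< P P′ {u} keep u-tight u∉ u∈′ = sum-mono-<
      (λ w → indicator-mono (λ (w-tight , w∉′) → w-tight , w∉′ ∘ keep w-tight) (misplaced? P′ w) (misplaced? P w))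
      u (subst₂ _<_ (sym (indicator-no (misplaced? P′ u) λ (_ , u∉′) → u∉′ u∈′))
                    (sym (indicator-yes (misplaced? P u) (u-tight , u∉))) (s≤s z≤n))

    saturate : (P : Family G s t) → load G P ≗ load G P₀ → lo ∈ᵖ P j → hi ∈ᵖ P j → Acc _<_ (misplaced P) →
      Σ[ P′ ∈ Family G s t ] Saturated j P′
    saturate P P≗P₀ lo∈ hi∈ (acc smaller) = step (any? (misplaced? P))
      where
      step : Dec (∃ λ u → Tight u × ¬ u ∈ᵖ P j) → Σ[ P′ ∈ Family G s t ] Saturated j P′
      step (no none) = P , P≗P₀ , λ {w} w-tight → decidable-stable (w ∈ᵖ? P j) λ w∉ → none (w , w-tight , w∉)
      step (yes (u , u-tight , u∉)) = continue (improve P P≗P₀ u-tight u∉ (crossing-at P lo∈ hi∈ u-tight u∉))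
        where
        continue : Improvement P u → Σ[ P′ ∈ Family G s t ] Saturated j P′
        continue (P′ , P′≗P₀ , keep , u∈′) =
          saturate P′ P′≗P₀ (keep lo-tight lo∈) (keep hi-tight hi∈) (smaller (misplaced-< P P′ keep u-tight u∉ u∈′))

  tight-extremes : ∀ {t₀} → Tight t₀ → Σ[ lo ∈ Fin n ] Σ[ hi ∈ Fin n ] TightRange lo hi
  tight-extremes t₀-tight =
    let lo , lo-tight , lo≤ = least {R = Walk G} _++ʷ_ (λ {x} → [ x ]) tight? tight-comparable t₀-tight (allFin n)
        hi , hi-tight , ≤hi = least {R = flip (Walk G)} (flip _++ʷ_) (λ {x} → [ x ]) tight?
                                (λ x y → ⊎-swap (tight-comparable x y)) t₀-tight (allFin n)
    in lo , hi , lo-tight , hi-tight , λ w-tight → lo≤ (∈-allFin _) w-tight , ≤hi (∈-allFin _) w-tight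

  saturated-path : Σ[ j ∈ Fin k ] Σ[ P ∈ Family G s t ] Saturated j P
  saturated-path = from-tight (any? tight?)
    where
    from-extremes : Σ[ lo ∈ Fin n ] Σ[ hi ∈ Fin n ] TightRange lo hi → Σ[ j ∈ Fin k ] Σ[ P ∈ Family G s t ] Saturated j P
    from-extremes (lo , hi , lo-tight , hi-tight , between) = through (tight-shared-path {P₀} (λ _ → refl) lo-tight hi-tight hi-tight)
      where
      through : ∃[ j ] (lo ∈ᵖ P₀ j × hi ∈ᵖ P₀ j × hi ∈ᵖ P₀ j) →
        Σ[ j ∈ Fin k ] Σ[ P ∈ Family G s t ] Saturated j P
      through (j , lo∈ , hi∈ , _) = j , Saturation.saturate j lo-tight hi-tight between P₀ (λ _ → refl) lo∈ hi∈ (<-wellFounded _)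
    from-tight : Dec (∃ Tight) → Σ[ j ∈ Fin k ] Σ[ P ∈ Family G s t ] Saturated j P
    from-tight (no none)           = fromℕ< (≤-<-trans z≤n 3d<k) , P₀ , (λ _ → refl) , λ w-tight → ⊥-elim (none (_ , w-tight))
    from-tight (yes (_ , t₀-tight)) = from-extremes (tight-extremes t₀-tight)

-- Routings

≤-minus⇔+≤ : ∀ (i j m : ℤ) → (i ≤ℤ j - m) ⇔ (i +ℤ m ≤ℤ j)
≤-minus⇔+≤ i j m = mk⇔
  (λ i≤j-m → subst (i +ℤ m ≤ℤ_) (//-rightDividesˡ m j) (+ℤ-monoˡ-≤ m i≤j-m))
  (λ i+m≤j → subst (_≤ℤ j - m) (//-rightDividesʳ m i) (+ℤ-monoˡ-≤ (- m) i+m≤j))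

+≤+-minus⇔ : ∀ a k d → (+ a ≤ℤ + k - + d) ⇔ (a + d ≤ k)
+≤+-minus⇔ a k d = mk⇔ (drop‿+≤+ ∘ Equivalence.to ℤ-version) (Equivalence.from ℤ-version ∘ +≤+)
  where ℤ-version = ≤-minus⇔+≤ (+ a) (+ k) (+ d)

module _ {n : ℕ} {G : Digraph n} {k : ℕ} {s t : Fin (suc k) → Fin n} where

  load-punchIn : (P : Family G s t) (j : Fin (suc k)) (x : Fin n) →
    load G P x ≡ indicator (x ∈ᵖ? P j) + load G (P ∘ punchIn j) x
  load-punchIn P j x = begin
    load G P x
      ≡⟨ load-sum P x ⟩
    sum (λ i → indicator (x ∈ᵖ? P i))
      ≡⟨ sum-remove {i = j} (λ i → indicator (x ∈ᵖ? P i)) ⟩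
    indicator (x ∈ᵖ? P j) + sum (λ i → indicator (x ∈ᵖ? P (punchIn j i)))
      ≡⟨ cong (_+_ (indicator (x ∈ᵖ? P j))) (sym (load-sum (P ∘ punchIn j) x)) ⟩
    indicator (x ∈ᵖ? P j) + load G (P ∘ punchIn j) x ∎
    where open ≡-Reasoning

  remove-saturated : ∀ {d} (P : Family G s t) (j : Fin (suc k)) → (∀ x → load G P x + d ≤ suc k) →
    (∀ {x} → load G P x + d ≡ suc k → x ∈ᵖ P j) → ∀ x → load G (P ∘ punchIn j) x + d ≤ k
  remove-saturated {d} P j bound saturated x = ≤-pred (by-membership (x ∈ᵖ? P j))
    where
    rest = load G (P ∘ punchIn j) x
    by-membership : Dec (x ∈ᵖ P j) → suc (rest + d) ≤ suc k
    by-membership (yes x∈) = subst (λ a → a + d ≤ suc k)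
      (trans (load-punchIn P j x) (cong (_+ rest) (indicator-yes (x ∈ᵖ? P j) x∈))) (bound x)
    by-membership (no x∉) = subst (λ a → suc (a + d) ≤ suc k)
      (trans (load-punchIn P j x) (cong (_+ rest) (indicator-no (x ∈ᵖ? P j) x∉))) (≤∧≢⇒< (bound x) (x∉ ∘ saturated))

module _ {n : ℕ} {G : Digraph n} (acyclic : Acyclic G) {d : ℕ} where

  drop-pair : ∀ {k} {s t : Fin (suc k) → Fin n} → 3 * d < suc k → Routing G (+ suc k - + d) s t →
    Σ[ j ∈ Fin (suc k) ] Routing G (+ k - + d) (s ∘ punchIn j) (t ∘ punchIn j)
  drop-pair {k} 3d<k (P₀ , congestion) with Tight.saturated-path acyclic 3d<k P₀
  ... | j , P , P≗P₀ , saturated =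
    j , P ∘ punchIn j , λ x → Equivalence.from (+≤+-minus⇔ _ k d) (remove-saturated P j bound saturated′ x)
    where
    bound : ∀ x → load G P x + d ≤ suc k
    bound x = subst (λ a → a + d ≤ suc k) (sym (P≗P₀ x)) (Equivalence.to (+≤+-minus⇔ _ _ d) (congestion x))
    saturated′ : ∀ {x} → load G P x + d ≡ suc k → x ∈ᵖ P j
    saturated′ {x} = saturated ∘ trans (cong (_+ d) (sym (P≗P₀ x)))

  drop-pairs : ∀ e {k} {s t : Fin k → Fin n} → k ≡ e + 3 * d → Routing G (+ k - + d) s t → SubRouting G d s t (3 * d)
  drop-pairs zero    refl R = id , id , R
  drop-pairs (suc e) refl R with drop-pair (s≤s (m≤n+m (3 * d) e)) R
  ... | j , R′ with drop-pairs e refl R′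
  ...   | ι , ι-inj , R″ = punchIn j ∘ ι , ι-inj ∘ punchIn-injective j _ _ , R″

  restrict-to-3d : ∀ {k} {s t : Fin k → Fin n} → 3 * d ≤ k → Routing G (+ k - + d) s t → SubRouting G d s t (3 * d)
  restrict-to-3d {k} 3d≤k = drop-pairs (k ∸ 3 * d) (sym (m∸n+n≡m 3d≤k))

  restrict-to-≤3d : ∀ {k} {s t : Fin k → Fin n} → Routing G (+ k - + d) s t → ∃[ m ] (m ≤ 3 * d × SubRouting G d s t m)
  restrict-to-≤3d {k} R with k ≤? 3 * d
  ... | yes k≤3d = k , k≤3d , id , id , R
  ... | no k≰3d  = 3 * d , ≤-refl , restrict-to-3d (<⇒≤ (≰⇒> k≰3d)) R

module _ {n : ℕ} {G : Digraph n} {k m : ℕ} {s t : Fin k → Fin n} (Q : Family G s t)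
  {ι : Fin m → Fin k} (ι-inj : Injective _≡_ _≡_ ι) (R : Family G (s ∘ ι) (t ∘ ι)) where

  open DecMembership (_≟_ {n}) using (_∈?_)

  private
    fill : ∀ i → Dec (∃[ j ] ι j ≡ i) → Path G (s i) (t i)
    fill i (yes (j , ιj≡i)) = subst (λ i → Path G (s i) (t i)) ιj≡i (R j)
    fill i (no _)           = Q i

    vertices-subst : ∀ {i i′} (i≡i′ : i ≡ i′) (p : Path G (s i) (t i)) →
      vertices G (walk (subst (λ i → Path G (s i) (t i)) i≡i′ p)) ≡ vertices G (walk p)
    vertices-subst refl p = refl

    vertices-fill : ∀ j (found : Dec (∃[ j′ ] ι j′ ≡ ι j)) → vertices G (walk (fill (ι j) found)) ≡ vertices G (walk (R j))
    vertices-fill j (yes (j′ , ιj′≡ιj)) =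
      trans (vertices-subst ιj′≡ιj (R j′)) (cong (λ j → vertices G (walk (R j))) (ι-inj ιj′≡ιj))
    vertices-fill j (no none)            = ⊥-elim (none (j , refl))

  extension : Family G s t
  extension i = fill i (any? (λ j → ι j ≟ i))

  load-extension : ∀ x → load G extension x ≤ load G R x + (k ∸ m)
  load-extension x = begin
    load G extension x
      ≡⟨ load-sum extension x ⟩
    sum (λ i → indicator (x ∈ᵖ? extension i))
      ≤⟨ sum≤sum∘inj+∸ ι ι-inj _ (λ i → indicator≤1 (x ∈ᵖ? extension i)) ⟩
    sum (λ j → indicator (x ∈ᵖ? extension (ι j))) + (k ∸ m)
      ≡⟨ cong (_+ (k ∸ m)) (sum-cong-≗ λ j → cong (indicator ∘ (x ∈?_)) (vertices-fill j (any? (λ j′ → ι j′ ≟ ι j)))) ⟩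
    sum (λ j → indicator (x ∈ᵖ? R j)) + (k ∸ m)
      ≡⟨ cong (_+ (k ∸ m)) (sym (load-sum R x)) ⟩
    load G R x + (k ∸ m) ∎
    where open ≤-Reasoning

extend-routing : ∀ {n} {G : Digraph n} {d k m} {s t : Fin k → Fin n} → Family G s t →
  SubRouting G d s t m → Routing G (+ k - + d) s t
extend-routing {G = G} {d} {k} {m} Q (ι , ι-inj , R , congestion) =
  extension Q ι-inj R , λ x → Equivalence.from (+≤+-minus⇔ _ k d) (begin
    load G (extension Q ι-inj R) x + d  ≤⟨ +-monoˡ-≤ d (load-extension Q ι-inj R x) ⟩
    load G R x + (k ∸ m) + d            ≡⟨ xy∙z≈xz∙y (load G R x) (k ∸ m) d ⟩
    load G R x + d + (k ∸ m)            ≤⟨ +-monoˡ-≤ (k ∸ m) (Equivalence.to (+≤+-minus⇔ _ m d) (congestion x)) ⟩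
    m + (k ∸ m)                         ≡⟨ m+[n∸m]≡n (injective⇒≤ ι-inj) ⟩
    k                                   ∎)
  where open ≤-Reasoning

corollary7 : ∀ {n : ℕ} (G : Digraph n) → Acyclic G →
    (d k : ℕ) (s t : Fin k → Fin n) → DistinctPairs s t →
    (∀ i → Path G (s i) (t i)) →
    (Routing G (+ k - + d) s t
       ⇔ (∃[ m ] (m ≤ 3 * d × Σ (Fin m → Fin k) λ ι →
            Injective _≡_ _≡_ ι × Routing G (+ m - + d) (s ∘ ι) (t ∘ ι))))
    × (3 * d ≤ k →
        (Routing G (+ k - + d) s t
           ⇔ Σ (Fin (3 * d) → Fin k) λ ι →
               Injective _≡_ _≡_ ι × Routing G (+ (3 * d) - + d) (s ∘ ι) (t ∘ ι)))
corollary7 G acyclic d k s t _ Q =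
  mk⇔ (restrict-to-≤3d acyclic {d}) (λ (_ , _ , R) → extend-routing {d = d} Q R) ,
  λ 3d≤k → mk⇔ (restrict-to-3d acyclic {d} 3d≤k) (extend-routing {d = d} Q)
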